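{- Let $G$ be a graph with $v(G)$ vertices and $e(G)$ edges. Then $v(G) = \#G(0)$ and \[ e(G) = -\tfrac12 \frac{d}{dq}\#G(q)\Big|_{q=0}. \]
   Context: A graph means a finite undirected graph with no loops or multiple edges; it may be disconnected. For vertices $x,y$ of $G$, $d(x,y)$ is the length of a shortest path from $x$ to $y$, or $\infty$ if there is none. Let $Z_G(q)$ be the square matrix over $\mathbb{Z}[q]$, indexed by the vertices of $G$, with $(x,y)$-entry $q^{d(x,y)}$, using the convention $q^\infty=0$. Its determinant is a polynomial with constant term $1$. The magnitude of $G$ is $\#G(q)=\sum_{x,y\in G} Z_G(q)^{ -1}(x,y)$. This is a rational function in $q$ that is regular at $q=0$, equivalently a power series in $\mathbb{Z}[[q]]$. -}

module Defs where

open import Data.Nat using (ℕ; zero; suc; _∸_)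
open import Data.Fin using (Fin; toℕ; _<?_)
open import Data.Bool using (Bool; true; false; _∧_; _∨_; not; if_then_else_)
open import Data.Integer using (ℤ; +_; _+_; _*_)
open import Data.Product using (Σ; _×_)
open import Relation.Binary.PropositionalEquality using (_≡_)
open import Relation.Nullary using (does)
open import Data.Fin using (_≟_)

record Graph (n : ℕ) : Set where
  field
    adj   : Fin n → Fin n → Bool
    sym   : ∀ x y → adj x y ≡ adj y x
    irrefl : ∀ x → adj x x ≡ false
open Graph public

sumFin : ∀ {n} → (Fin n → ℤ) → ℤ
sumFin {zero}  f = + 0
sumFin {suc n} f = f Data.Fin.zero + sumFin (λ i → f (Data.Fin.suc i))

anyFin : ∀ {n} → (Fin n → Bool) → Bool
anyFin {zero}  f = false
anyFin {suc n} f = f Data.Fin.zero ∨ anyFin (λ i → f (Data.Fin.suc i))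

v : ∀ {n} → Graph n → ℕ
v {n} G = n

e : ∀ {n} → Graph n → ℤ
e G = sumFin (λ x → sumFin (λ y →
        if does (x <? y) ∧ adj G x y then + 1 else + 0))

reach≤ : ∀ {n} → Graph n → ℕ → Fin n → Fin n → Bool
reach≤ G zero    x y = does (x ≟ y)
reach≤ G (suc k) x y = reach≤ G k x y ∨ anyFin (λ z → reach≤ G k x z ∧ adj G z y)

-- distIs G k x y : d(x,y) = k  (d = ∞ when no path exists, so never equal to any k).
distIs : ∀ {n} → Graph n → ℕ → Fin n → Fin n → Bool
distIs G zero    x y = reach≤ G zero x y
distIs G (suc k) x y = reach≤ G (suc k) x y ∧ not (reach≤ G k x y)

PowerSeries : Set
PowerSeries = ℕ → ℤ

_⊛_ : PowerSeries → PowerSeries → PowerSeries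
(f ⊛ g) k = sumFin {suc k} (λ i → f (toℕ i) * g (k ∸ toℕ i))

_⊕_ : PowerSeries → PowerSeries → PowerSeries
(f ⊕ g) k = f k + g k

sumPS : ∀ {n} → (Fin n → PowerSeries) → PowerSeries
sumPS f k = sumFin (λ i → f i k)

PSMatrix : ℕ → Set
PSMatrix n = Fin n → Fin n → PowerSeries

_·_ : ∀ {n} → PSMatrix n → PSMatrix n → PSMatrix n
(A · B) x y = sumPS (λ z → A x z ⊛ B z y)

identityPS : ∀ {n} → PSMatrix n
identityPS x y zero    = if does (x ≟ y) then + 1 else + 0
identityPS x y (suc k) = + 0

-- Z_G(q): (x,y)-entry q^{d(x,y)}, with q^∞ = 0.
Z : ∀ {n} → Graph n → PSMatrix n
Z G x y k = if distIs G k x y then + 1 else + 0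

IsInverse : ∀ {n} → PSMatrix n → PSMatrix n → Set
IsInverse A M = (∀ x y k → (A · M) x y k ≡ identityPS x y k)
              × (∀ x y k → (M · A) x y k ≡ identityPS x y k)

-- Sum of all entries of a matrix: for M = Z_G^{-1} this is the magnitude #G(q) ∈ ℤ[[q]].
entrySum : ∀ {n} → PSMatrix n → PowerSeries
entrySum M = sumPS (λ x → sumPS (λ y → M x y))

module Submission where

-- Write A_k for the k-th coefficient of a matrix A over ℤ[[q]],
-- so that (A·B)_k = Σ_{i+j=k} A_i B_j.  The distance matrix Z = Z_G is
-- unipotent: Z_0 = I, because d(x,y) = 0 iff x = y.  For any unipotent A,
-- (A·X)_{k+1} = X_{k+1} + Σ_{i+j=k} A_{i+1} X_j, which gives
--   * a right inverse R, by the recursion R_0 = I, R_{k+1} = -Σ A_{i+1} R_j;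
--   * left cancellation A·X = A·Y ⇒ X = Y, by strong induction on degrees;
--   * hence R·A = I, since A·(R·A) = (A·R)·A = A = A·I (associativity);
--   * for every M with A·M = I: M_0 = I and M_1 = -A_1.
-- For Z_G, the coefficient Z_1 is the adjacency matrix, whose entries add up
-- to twice the number of edges; summing all entries of M_0 and M_1 gives
-- #G(0) = v(G) and #G'(0) = -2 e(G).

open import Defs hiding (sym)
open import Data.Nat using (ℕ; zero; suc; _∸_; _<_; _≤_; s≤s; s≤s⁻¹)
open import Data.Nat.Properties using (≤-trans; ≤-refl; m∸n≤m)
open import Data.Nat.Induction using (<-rec)
open import Data.Fin using (Fin; zero; suc; toℕ; _≟_; _<?_)
open import Data.Fin.Properties using (<-cmp; <-irrefl; suc-injective)
open import Data.Bool using (Bool; false; _∧_; _∨_; if_then_else_)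
open import Data.Bool.Properties using (∨-identityʳ; ∧-identityʳ)
open import Data.Integer using (ℤ; +_; -_; _*_; _+_; -1ℤ)
import Data.Integer.Properties as ℤP
open import Algebra.Properties.Semiring.Sum ℤP.+-*-semiring
  using (sum; sum-cong-≗; sum-replicate-zero; ∑-distrib-+; ∑-comm; *-distribˡ-sum; *-distribʳ-sum)
open import Algebra.Properties.AbelianGroup ℤP.+-0-abelianGroup using (∙-cancelʳ; inverseˡ-unique)
open import Data.Product using (Σ; _×_; _,_)
open import Function using (_∘_)
open import Relation.Binary using (tri<; tri≈; tri>)
open import Relation.Binary.PropositionalEquality
open import Relation.Nullary using (does; yes; no)
open import Relation.Nullary.Decidable using (dec-true; dec-false)
open ≡-Reasoning

-- The recursive sum of Defs is the standard library's `sum`; the algebraic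
-- laws of finite sums below are transported from the library along this.
sumFin≡sum : ∀ {n} (f : Fin n → ℤ) → sumFin f ≡ sum f
sumFin≡sum {zero}  f = refl
sumFin≡sum {suc n} f = cong (_+_ (f zero)) (sumFin≡sum (f ∘ suc))

sum-cong : ∀ {n} {f g : Fin n → ℤ} → (∀ i → f i ≡ g i) → sumFin f ≡ sumFin g
sum-cong {f = f} {g} f≗g = trans (sumFin≡sum f) (trans (sum-cong-≗ f≗g) (sym (sumFin≡sum g)))

sum-zero : ∀ {n} (f : Fin n → ℤ) → (∀ i → f i ≡ + 0) → sumFin f ≡ + 0
sum-zero {n} f f≗0 = trans (sum-cong f≗0) (trans (sumFin≡sum {n} (λ _ → + 0)) (sum-replicate-zero n))

sum-+ : ∀ {n} (f g : Fin n → ℤ) → sumFin (λ i → f i + g i) ≡ sumFin f + sumFin g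
sum-+ f g = trans (sumFin≡sum (λ i → f i + g i))
  (trans (∑-distrib-+ f g) (sym (cong₂ _+_ (sumFin≡sum f) (sumFin≡sum g))))

sum-*ˡ : ∀ {n} c (f : Fin n → ℤ) → c * sumFin f ≡ sumFin (λ i → c * f i)
sum-*ˡ c f = trans (cong (c *_) (sumFin≡sum f)) (trans (*-distribˡ-sum c f) (sym (sumFin≡sum (λ i → c * f i))))

sum-*ʳ : ∀ {n} c (f : Fin n → ℤ) → sumFin f * c ≡ sumFin (λ i → f i * c)
sum-*ʳ c f = trans (cong (_* c) (sumFin≡sum f)) (trans (*-distribʳ-sum c f) (sym (sumFin≡sum (λ i → f i * c))))

sum-neg : ∀ {n} (f : Fin n → ℤ) → - sumFin f ≡ sumFin (λ i → - f i)
sum-neg f = begin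
  - sumFin f                  ≡⟨ sym (ℤP.-1*i≡-i _) ⟩
  -1ℤ * sumFin f              ≡⟨ sum-*ˡ -1ℤ f ⟩
  sumFin (λ i → -1ℤ * f i)    ≡⟨ sum-cong (λ i → ℤP.-1*i≡-i (f i)) ⟩
  sumFin (λ i → - f i)        ∎

sum-swap : ∀ {m n} (f : Fin m → Fin n → ℤ) →
  sumFin (λ i → sumFin (f i)) ≡ sumFin (λ j → sumFin (λ i → f i j))
sum-swap f = begin
  sumFin (λ i → sumFin (f i))      ≡⟨ double f ⟩
  sum (λ i → sum (f i))            ≡⟨ ∑-comm f ⟩
  sum (λ j → sum (λ i → f i j))    ≡⟨ sym (double (λ j i → f i j)) ⟩
  sumFin (λ j → sumFin (λ i → f i j)) ∎
  where
  double : ∀ {m n} (g : Fin m → Fin n → ℤ) → sumFin (λ i → sumFin (g i)) ≡ sum (λ i → sum (g i))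
  double g = trans (sumFin≡sum (λ i → sumFin (g i))) (sum-cong-≗ (λ i → sumFin≡sum (g i)))

sum-single : ∀ {n} (x : Fin n) (f : Fin n → ℤ) → (∀ z → z ≢ x → f z ≡ + 0) → sumFin f ≡ f x
sum-single zero f vanish = begin
  f zero + sumFin (f ∘ suc) ≡⟨ cong (_+_ (f zero)) (sum-zero _ (λ z → vanish (suc z) λ ())) ⟩
  f zero + + 0                ≡⟨ ℤP.+-identityʳ _ ⟩
  f zero                      ∎
sum-single (suc x) f vanish = begin
  f zero + sumFin (f ∘ suc) ≡⟨ cong (_+ sumFin (f ∘ suc)) (vanish zero λ ()) ⟩
  + 0 + sumFin (f ∘ suc)      ≡⟨ ℤP.+-identityˡ _ ⟩
  sumFin (f ∘ suc)            ≡⟨ sum-single x (f ∘ suc) (λ z z≢x → vanish (suc z) (z≢x ∘ suc-injective)) ⟩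
  f (suc x)                   ∎

sum-ones : ∀ n → sumFin {n} (λ _ → + 1) ≡ + n
sum-ones zero    = refl
sum-ones (suc n) = cong (_+_ (+ 1)) (sum-ones n)

antidiagonal : ℕ → (ℕ → ℕ → ℤ) → ℤ
antidiagonal k h = sumFin {suc k} (λ i → h (toℕ i) (k ∸ toℕ i))

antidiagonal-first : ∀ k (h : ℕ → ℕ → ℤ) → (∀ i j → h (suc i) j ≡ + 0) → antidiagonal k h ≡ h 0 k
antidiagonal-first k h vanish =
  trans (cong (_+_ (h 0 k)) (sum-zero {k} _ (λ i → vanish (toℕ i) _))) (ℤP.+-identityʳ _)

antidiagonal-last : ∀ k (h : ℕ → ℕ → ℤ) → (∀ i j → h i (suc j) ≡ + 0) → antidiagonal k h ≡ h k 0
antidiagonal-last zero    h vanish = ℤP.+-identityʳ _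
antidiagonal-last (suc k) h vanish = begin
  h 0 (suc k) + antidiagonal k (h ∘ suc) ≡⟨ cong (_+ antidiagonal k (h ∘ suc)) (vanish 0 k) ⟩
  + 0 + antidiagonal k (h ∘ suc)         ≡⟨ ℤP.+-identityˡ _ ⟩
  antidiagonal k (h ∘ suc)               ≡⟨ antidiagonal-last k (h ∘ suc) (vanish ∘ suc) ⟩
  h (suc k) 0                            ∎

antidiagonal-cong : ∀ k {h h′ : ℕ → ℕ → ℤ} → (∀ i j → h i j ≡ h′ i j) →
  antidiagonal k h ≡ antidiagonal k h′
antidiagonal-cong k h≗h′ = sum-cong {suc k} (λ i → h≗h′ (toℕ i) (k ∸ toℕ i))

-- Σ_{i+c=k} Σ_{a+b=i} F a b c = Σ_{a+d=k} Σ_{b+c=d} F a b c: both are the sum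
-- over a + b + c = k.  This reindexing is the heart of associativity.
antidiagonal-assoc : ∀ k (F : ℕ → ℕ → ℕ → ℤ) →
  antidiagonal k (λ i c → antidiagonal i (λ a b → F a b c))
  ≡ antidiagonal k (λ a d → antidiagonal d (λ b c → F a b c))
antidiagonal-assoc zero    F = refl
antidiagonal-assoc (suc k) F = begin
  (F 0 0 (suc k) + + 0) + sumFin (λ i → S i + T i)
    ≡⟨ cong₂ _+_ (ℤP.+-identityʳ (F 0 0 (suc k))) (sum-+ S T) ⟩
  F 0 0 (suc k) + (sumFin S + sumFin T)
    ≡⟨ cong (λ t → F 0 0 (suc k) + (sumFin S + t)) (antidiagonal-assoc k (F ∘ suc)) ⟩
  F 0 0 (suc k) + (sumFin S + R)
    ≡⟨ sym (ℤP.+-assoc (F 0 0 (suc k)) (sumFin S) R) ⟩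
  (F 0 0 (suc k) + sumFin S) + R ∎
  where
  S T : Fin (suc k) → ℤ
  S i = F 0 (suc (toℕ i)) (k ∸ toℕ i)
  T i = antidiagonal (toℕ i) (λ a b → F (suc a) b (k ∸ toℕ i))
  R : ℤ
  R = antidiagonal k (λ a d → antidiagonal d (λ b c → F (suc a) b c))

Mat : ℕ → Set
Mat n = Fin n → Fin n → ℤ

infixl 7 _⋆_
_⋆_ : ∀ {n} → Mat n → Mat n → Mat n
(A ⋆ B) x y = sumFin (λ z → A x z * B z y)

indicator : Bool → ℤ
indicator b = if b then + 1 else + 0

δ : ∀ {n} → Mat n
δ x y = indicator (does (x ≟ y))

δ-diag : ∀ {n} (x : Fin n) → δ x x ≡ + 1
δ-diag x rewrite dec-true (x ≟ x) refl = refl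

δ-off : ∀ {n} {x y : Fin n} → x ≢ y → δ x y ≡ + 0
δ-off {x = x} {y} x≢y rewrite dec-false (x ≟ y) x≢y = refl

⋆-congˡ : ∀ {n} {A A′ : Mat n} → (∀ a b → A a b ≡ A′ a b) →
  ∀ (B : Mat n) x y → (A ⋆ B) x y ≡ (A′ ⋆ B) x y
⋆-congˡ {n} A≗A′ B x y = sum-cong {n} (λ z → cong (_* B z y) (A≗A′ x z))

⋆-congʳ : ∀ {n} (A : Mat n) {B B′ : Mat n} → (∀ a b → B a b ≡ B′ a b) →
  ∀ x y → (A ⋆ B) x y ≡ (A ⋆ B′) x y
⋆-congʳ {n} A B≗B′ x y = sum-cong {n} (λ z → cong (A x z *_) (B≗B′ z y))

⋆-identityˡ : ∀ {n} (B : Mat n) x y → (δ ⋆ B) x y ≡ B x y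
⋆-identityˡ B x y = begin
  sumFin (λ z → δ x z * B z y)
    ≡⟨ sum-single x (λ z → δ x z * B z y)
         (λ z z≢x → trans (cong (_* B z y) (δ-off (z≢x ∘ sym))) (ℤP.*-zeroˡ (B z y))) ⟩
  δ x x * B x y                ≡⟨ cong (_* B x y) (δ-diag x) ⟩
  + 1 * B x y                  ≡⟨ ℤP.*-identityˡ _ ⟩
  B x y                        ∎

⋆-identityʳ : ∀ {n} (A : Mat n) x y → (A ⋆ δ) x y ≡ A x y
⋆-identityʳ A x y = begin
  sumFin (λ z → A x z * δ z y)
    ≡⟨ sum-single y (λ z → A x z * δ z y)
         (λ z z≢y → trans (cong (A x z *_) (δ-off z≢y)) (ℤP.*-zeroʳ (A x z))) ⟩
  A x y * δ y y                ≡⟨ cong (A x y *_) (δ-diag y) ⟩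
  A x y * + 1                  ≡⟨ ℤP.*-identityʳ _ ⟩
  A x y                        ∎

⋆-assoc : ∀ {n} (A B C : Mat n) x y → (A ⋆ B ⋆ C) x y ≡ (A ⋆ (B ⋆ C)) x y
⋆-assoc A B C x y = begin
  sumFin (λ w → sumFin (λ z → A x z * B z w) * C w y)
    ≡⟨ sum-cong (λ w → sum-*ʳ (C w y) (λ z → A x z * B z w)) ⟩
  sumFin (λ w → sumFin (λ z → A x z * B z w * C w y))
    ≡⟨ sum-swap (λ w z → A x z * B z w * C w y) ⟩
  sumFin (λ z → sumFin (λ w → A x z * B z w * C w y))
    ≡⟨ sum-cong (λ z → sum-cong (λ w → ℤP.*-assoc (A x z) (B z w) (C w y))) ⟩
  sumFin (λ z → sumFin (λ w → A x z * (B z w * C w y)))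
    ≡⟨ sum-cong (λ z → sym (sum-*ˡ (A x z) (λ w → B z w * C w y))) ⟩
  sumFin (λ z → A x z * sumFin (λ w → B z w * C w y)) ∎

⋆-sumˡ : ∀ {n m} (P : Fin m → Mat n) (Q : Mat n) x y →
  ((λ a b → sumFin (λ j → P j a b)) ⋆ Q) x y ≡ sumFin (λ j → (P j ⋆ Q) x y)
⋆-sumˡ P Q x y = trans (sum-cong (λ z → sum-*ʳ (Q z y) (λ j → P j x z))) (sum-swap (λ z j → P j x z * Q z y))

⋆-sumʳ : ∀ {n m} (Q : Mat n) (P : Fin m → Mat n) x y →
  (Q ⋆ (λ a b → sumFin (λ j → P j a b))) x y ≡ sumFin (λ j → (Q ⋆ P j) x y)
⋆-sumʳ Q P x y = trans (sum-cong (λ z → sum-*ˡ (Q x z) (λ j → P j z y))) (sum-swap (λ z j → Q x z * P j z y))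

coef : ∀ {n} → PSMatrix n → ℕ → Mat n
coef A k x y = A x y k

conv : ∀ {n} (A B : PSMatrix n) x y k →
  (A · B) x y k ≡ antidiagonal k (λ i j → (coef A i ⋆ coef B j) x y)
conv {n} A B x y k = sum-swap {n} {suc k} (λ z i → A x z (toℕ i) * B z y (k ∸ toℕ i))

·-congˡ : ∀ {n} {A A′ : PSMatrix n} → (∀ a b k → A a b k ≡ A′ a b k) →
  ∀ (B : PSMatrix n) x y k → (A · B) x y k ≡ (A′ · B) x y k
·-congˡ {n} A≗A′ B x y k =
  sum-cong {n} (λ z → sum-cong {suc k} (λ i → cong (_* B z y (k ∸ toℕ i)) (A≗A′ x z (toℕ i))))

-- Associativity: both sides have degree-k coefficient Σ_{a+b+c=k} A_a B_b C_c.
·-assoc : ∀ {n} (A B C : PSMatrix n) x y k → ((A · B) · C) x y k ≡ (A · (B · C)) x y k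
·-assoc A B C x y k = begin
  ((A · B) · C) x y k
    ≡⟨ conv (A · B) C x y k ⟩
  antidiagonal k (λ i c → (coef (A · B) i ⋆ coef C c) x y)
    ≡⟨ antidiagonal-cong k expandˡ ⟩
  antidiagonal k (λ i c → antidiagonal i (λ a b → (coef A a ⋆ coef B b ⋆ coef C c) x y))
    ≡⟨ antidiagonal-assoc k (λ a b c → (coef A a ⋆ coef B b ⋆ coef C c) x y) ⟩
  antidiagonal k (λ a d → antidiagonal d (λ b c → (coef A a ⋆ coef B b ⋆ coef C c) x y))
    ≡⟨ antidiagonal-cong k (λ a d → sym (expandʳ a d)) ⟩
  antidiagonal k (λ a d → (coef A a ⋆ coef (B · C) d) x y)
    ≡⟨ sym (conv A (B · C) x y k) ⟩
  (A · (B · C)) x y k ∎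
  where
  expandˡ : ∀ i c → (coef (A · B) i ⋆ coef C c) x y
                  ≡ antidiagonal i (λ a b → (coef A a ⋆ coef B b ⋆ coef C c) x y)
  expandˡ i c = trans (⋆-congˡ (λ a b → conv A B a b i) (coef C c) x y)
                      (⋆-sumˡ {m = suc i} (λ j → coef A (toℕ j) ⋆ coef B (i ∸ toℕ j)) (coef C c) x y)
  expandʳ : ∀ a d → (coef A a ⋆ coef (B · C) d) x y
                  ≡ antidiagonal d (λ b c → (coef A a ⋆ coef B b ⋆ coef C c) x y)
  expandʳ a d = begin
    (coef A a ⋆ coef (B · C) d) x y
      ≡⟨ ⋆-congʳ (coef A a) (λ b c → conv B C b c d) x y ⟩
    (coef A a ⋆ (λ b c → antidiagonal d (λ i j → (coef B i ⋆ coef C j) b c))) x y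
      ≡⟨ ⋆-sumʳ {m = suc d} (coef A a) (λ l → coef B (toℕ l) ⋆ coef C (d ∸ toℕ l)) x y ⟩
    antidiagonal d (λ b c → (coef A a ⋆ (coef B b ⋆ coef C c)) x y)
      ≡⟨ antidiagonal-cong d (λ b c → sym (⋆-assoc (coef A a) (coef B b) (coef C c) x y)) ⟩
    antidiagonal d (λ b c → (coef A a ⋆ coef B b ⋆ coef C c) x y) ∎

·-identityˡ : ∀ {n} (A : PSMatrix n) x y k → (identityPS · A) x y k ≡ A x y k
·-identityˡ A x y k = begin
  (identityPS · A) x y k                                  ≡⟨ conv identityPS A x y k ⟩
  antidiagonal k (λ i j → (coef identityPS i ⋆ coef A j) x y)
    ≡⟨ antidiagonal-first k (λ i j → (coef identityPS i ⋆ coef A j) x y)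
         (λ i j → sum-zero (λ z → + 0 * A z y j) (λ z → ℤP.*-zeroˡ (A z y j))) ⟩
  (δ ⋆ coef A k) x y                                      ≡⟨ ⋆-identityˡ (coef A k) x y ⟩
  A x y k                                                 ∎

·-identityʳ : ∀ {n} (A : PSMatrix n) x y k → (A · identityPS) x y k ≡ A x y k
·-identityʳ A x y k = begin
  (A · identityPS) x y k                                  ≡⟨ conv A identityPS x y k ⟩
  antidiagonal k (λ i j → (coef A i ⋆ coef identityPS j) x y)
    ≡⟨ antidiagonal-last k (λ i j → (coef A i ⋆ coef identityPS j) x y)
         (λ i j → sum-zero (λ z → A x z i * + 0) (λ z → ℤP.*-zeroʳ (A x z i))) ⟩
  (coef A k ⋆ δ) x y                                      ≡⟨ ⋆-identityʳ (coef A k) x y ⟩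
  A x y k                                                 ∎

module Unipotent {n} (A : PSMatrix n) (A₀≡δ : ∀ x y → A x y 0 ≡ δ x y) where

  -- Contribution of the higher coefficients of A to (A·X)_{k+1}.
  higher : PSMatrix n → ℕ → Mat n
  higher X k x y = antidiagonal k (λ i j → (coef A (suc i) ⋆ coef X j) x y)

  higher-cong : ∀ {X Y : PSMatrix n} k → (∀ j → j ≤ k → ∀ x y → X x y j ≡ Y x y j) →
    ∀ x y → higher X k x y ≡ higher Y k x y
  higher-cong k X≗Y x y =
    sum-cong {suc k} (λ i → ⋆-congʳ (coef A (suc (toℕ i))) (X≗Y (k ∸ toℕ i) (m∸n≤m k (toℕ i))) x y)

  ·-coef-zero : ∀ (X : PSMatrix n) x y → (A · X) x y 0 ≡ X x y 0
  ·-coef-zero X x y = begin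
    (A · X) x y 0                   ≡⟨ conv A X x y 0 ⟩
    (coef A 0 ⋆ coef X 0) x y + + 0 ≡⟨ ℤP.+-identityʳ _ ⟩
    (coef A 0 ⋆ coef X 0) x y       ≡⟨ ⋆-congˡ A₀≡δ (coef X 0) x y ⟩
    (δ ⋆ coef X 0) x y              ≡⟨ ⋆-identityˡ (coef X 0) x y ⟩
    X x y 0                         ∎

  ·-coef-suc : ∀ (X : PSMatrix n) x y k → (A · X) x y (suc k) ≡ X x y (suc k) + higher X k x y
  ·-coef-suc X x y k = begin
    (A · X) x y (suc k)                                    ≡⟨ conv A X x y (suc k) ⟩
    (coef A 0 ⋆ coef X (suc k)) x y + higher X k x y       ≡⟨ cong (_+ higher X k x y) lowest ⟩
    X x y (suc k) + higher X k x y                         ∎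
    where
    lowest : (coef A 0 ⋆ coef X (suc k)) x y ≡ X x y (suc k)
    lowest = trans (⋆-congˡ A₀≡δ (coef X (suc k)) x y) (⋆-identityˡ (coef X (suc k)) x y)

  -- The right inverse, computed with an explicit recursion bound b; its
  -- degree-k coefficient is correct (and independent of b) once k < b.
  rinv-bounded : ℕ → PSMatrix n
  rinv-bounded zero    x y k       = + 0
  rinv-bounded (suc b) x y zero    = δ x y
  rinv-bounded (suc b) x y (suc k) = - higher (rinv-bounded b) k x y

  bound-irrelevant : ∀ b b′ k → k < b → k < b′ → ∀ x y → rinv-bounded b x y k ≡ rinv-bounded b′ x y k
  bound-irrelevant (suc b) (suc b′) zero    _ _ x y = refl
  bound-irrelevant (suc b) (suc b′) (suc k) k<b k<b′ x y =
    cong -_ (higher-cong k (λ j j≤k → bound-irrelevant b b′ j (below k<b j≤k) (below k<b′ j≤k)) x y)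
    where
    below : ∀ {c j} → suc k < suc c → j ≤ k → j < c
    below k<c j≤k = ≤-trans (s≤s j≤k) (s≤s⁻¹ k<c)

  rinv : PSMatrix n
  rinv x y k = rinv-bounded (suc k) x y k

  rinv-suc : ∀ x y k → rinv x y (suc k) ≡ - higher rinv k x y
  rinv-suc x y k = cong -_ (higher-cong k
    (λ j j≤k → bound-irrelevant (suc k) (suc j) j (s≤s j≤k) ≤-refl) x y)

  -- A·R = I: the recursion was chosen to cancel the higher terms.
  rinv-right : ∀ x y k → (A · rinv) x y k ≡ identityPS x y k
  rinv-right x y zero    = ·-coef-zero rinv x y
  rinv-right x y (suc k) = begin
    (A · rinv) x y (suc k)                   ≡⟨ ·-coef-suc rinv x y k ⟩
    rinv x y (suc k) + higher rinv k x y     ≡⟨ cong (_+ higher rinv k x y) (rinv-suc x y k) ⟩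
    - higher rinv k x y + higher rinv k x y  ≡⟨ ℤP.+-inverseˡ (higher rinv k x y) ⟩
    + 0                                      ∎

  cancel : ∀ {X Y : PSMatrix n} → (∀ x y k → (A · X) x y k ≡ (A · Y) x y k) →
    ∀ k x y → X x y k ≡ Y x y k
  cancel {X} {Y} AX≡AY = <-rec (λ k → ∀ x y → X x y k ≡ Y x y k) step
    where
    step : ∀ k → (∀ {j} → j < k → ∀ x y → X x y j ≡ Y x y j) → ∀ x y → X x y k ≡ Y x y k
    step zero    _  x y = trans (sym (·-coef-zero X x y)) (trans (AX≡AY x y 0) (·-coef-zero Y x y))
    step (suc k) ih x y = ∙-cancelʳ (higher Y k x y) _ _ (begin
      X x y (suc k) + higher Y k x y
        ≡⟨ cong (_+_ (X x y (suc k))) (higher-cong k (λ j j≤k x y → sym (ih (s≤s j≤k) x y)) x y) ⟩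
      X x y (suc k) + higher X k x y  ≡⟨ sym (·-coef-suc X x y k) ⟩
      (A · X) x y (suc k)             ≡⟨ AX≡AY x y (suc k) ⟩
      (A · Y) x y (suc k)             ≡⟨ ·-coef-suc Y x y k ⟩
      Y x y (suc k) + higher Y k x y  ∎)

  -- R·A = I, by cancelling A from A·(R·A) = (A·R)·A = A = A·I.
  rinv-left : ∀ x y k → (rinv · A) x y k ≡ identityPS x y k
  rinv-left x y k = cancel A·rinv·A≡A·I k x y
    where
    A·rinv·A≡A·I : ∀ x y k → (A · (rinv · A)) x y k ≡ (A · identityPS) x y k
    A·rinv·A≡A·I x y k = begin
      (A · (rinv · A)) x y k      ≡⟨ sym (·-assoc A rinv A x y k) ⟩
      ((A · rinv) · A) x y k      ≡⟨ ·-congˡ rinv-right A x y k ⟩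
      (identityPS · A) x y k      ≡⟨ ·-identityˡ A x y k ⟩
      A x y k                     ≡⟨ sym (·-identityʳ A x y k) ⟩
      (A · identityPS) x y k      ∎

  invertible : IsInverse A rinv
  invertible = rinv-right , rinv-left

  module RightInverse (M : PSMatrix n) (AM≡I : ∀ x y k → (A · M) x y k ≡ identityPS x y k) where

    coef-zero : ∀ x y → M x y 0 ≡ δ x y
    coef-zero x y = trans (sym (·-coef-zero M x y)) (AM≡I x y 0)

    coef-one : ∀ x y → M x y 1 ≡ - A x y 1
    coef-one x y = inverseˡ-unique (M x y 1) (A x y 1) (begin
      M x y 1 + A x y 1             ≡⟨ cong (_+_ (M x y 1)) (sym higher₀) ⟩
      M x y 1 + higher M 0 x y      ≡⟨ sym (·-coef-suc M x y 0) ⟩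
      (A · M) x y 1                 ≡⟨ AM≡I x y 1 ⟩
      + 0                           ∎)
      where
      higher₀ : higher M 0 x y ≡ A x y 1
      higher₀ = begin
        (coef A 1 ⋆ coef M 0) x y + + 0 ≡⟨ ℤP.+-identityʳ _ ⟩
        (coef A 1 ⋆ coef M 0) x y       ≡⟨ ⋆-congʳ (coef A 1) coef-zero x y ⟩
        (coef A 1 ⋆ δ) x y              ≡⟨ ⋆-identityʳ (coef A 1) x y ⟩
        A x y 1                         ∎

anyFin-false : ∀ {n} → anyFin {n} (λ _ → false) ≡ false
anyFin-false {zero}  = refl
anyFin-false {suc n} = anyFin-false {n}

anyFin-single : ∀ {n} (x : Fin n) (g : Fin n → Bool) → anyFin (λ z → does (x ≟ z) ∧ g z) ≡ g x
anyFin-single {suc n} zero    g = trans (cong (g zero ∨_) (anyFin-false {n})) (∨-identityʳ _)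
anyFin-single {suc n} (suc x) g = anyFin-single x (g ∘ suc)

module _ {n} (G : Graph n) where

  distance-unipotent : ∀ x y → Z G x y 0 ≡ δ x y
  distance-unipotent x y = refl

  distance-one : ∀ x y → distIs G 1 x y ≡ adj G x y
  distance-one x y with x ≟ y
  ... | yes refl = sym (irrefl G x)
  ... | no  _    = trans (∧-identityʳ _) (anyFin-single x (λ z → adj G z y))

  ordered : Fin n → Fin n → ℤ
  ordered x y = indicator (does (x <? y) ∧ adj G x y)

  adjacency-split : ∀ x y → indicator (adj G x y) ≡ ordered x y + ordered y x
  adjacency-split x y with <-cmp x y
  ... | tri< x<y _ y≮x rewrite dec-true (x <? y) x<y | dec-false (y <? x) y≮x = sym (ℤP.+-identityʳ _)
  ... | tri≈ _ refl _ rewrite dec-false (x <? x) (<-irrefl refl) | irrefl G x = refl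
  ... | tri> x≮y _ y<x rewrite dec-false (x <? y) x≮y | dec-true (y <? x) y<x | Graph.sym G x y =
    sym (ℤP.+-identityˡ _)

  adjacency-sum : sumFin (λ x → sumFin (λ y → indicator (adj G x y))) ≡ + 2 * e G
  adjacency-sum = begin
    sumFin (λ x → sumFin (λ y → indicator (adj G x y)))
      ≡⟨ sum-cong (λ x → trans (sum-cong (adjacency-split x)) (sum-+ (ordered x) (λ y → ordered y x))) ⟩
    sumFin (λ x → sumFin (ordered x) + sumFin (λ y → ordered y x))
      ≡⟨ sum-+ (λ x → sumFin (ordered x)) (λ x → sumFin (λ y → ordered y x)) ⟩
    e G + sumFin (λ x → sumFin (λ y → ordered y x))
      ≡⟨ cong (_+_ (e G)) (sym (sum-swap ordered)) ⟩
    e G + e G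
      ≡⟨ cong₂ _+_ (sym (ℤP.*-identityˡ (e G))) (sym (ℤP.*-identityˡ (e G))) ⟩
    + 1 * e G + + 1 * e G
      ≡⟨ sym (ℤP.*-distribʳ-+ (e G) (+ 1) (+ 1)) ⟩
    + 2 * e G ∎

  module Magnitude (M : PSMatrix n) (ZM≡I : ∀ x y k → (Z G · M) x y k ≡ identityPS x y k) where
    open Unipotent.RightInverse (Z G) distance-unipotent M ZM≡I

    magnitude-at-zero : entrySum M 0 ≡ + v G
    magnitude-at-zero = begin
      sumFin (λ x → sumFin (λ y → M x y 0)) ≡⟨ sum-cong (λ x → trans (sum-cong (coef-zero x)) (row x)) ⟩
      sumFin {n} (λ _ → + 1)                ≡⟨ sum-ones n ⟩
      + n                                   ∎
      where
      row : ∀ x → sumFin (δ x) ≡ + 1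
      row x = trans (sum-single x (δ x) (λ z z≢x → δ-off (z≢x ∘ sym))) (δ-diag x)

    magnitude-derivative : entrySum M 1 ≡ - (+ 2 * e G)
    magnitude-derivative = begin
      sumFin (λ x → sumFin (λ y → M x y 1))
        ≡⟨ sum-cong (λ x → sum-cong (λ y →
             trans (coef-one x y) (cong (-_ ∘ indicator) (distance-one x y)))) ⟩
      sumFin (λ x → sumFin (λ y → - indicator (adj G x y)))
        ≡⟨ sum-cong (λ x → sym (sum-neg (λ y → indicator (adj G x y)))) ⟩
      sumFin (λ x → - sumFin (λ y → indicator (adj G x y)))
        ≡⟨ sym (sum-neg (λ x → sumFin (λ y → indicator (adj G x y)))) ⟩
      - sumFin (λ x → sumFin (λ y → indicator (adj G x y)))
        ≡⟨ cong -_ adjacency-sum ⟩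
      - (+ 2 * e G) ∎

corollary3p10 : ∀ (n : ℕ) (G : Graph n) →
    Σ (PSMatrix n) (λ M → IsInverse (Z G) M)
    × (∀ (M : PSMatrix n) → IsInverse (Z G) M →
        (entrySum M 0 ≡ + v G) × (entrySum M 1 ≡ - (+ 2 * e G)))
corollary3p10 n G = (rinv , invertible) , magnitude
  where
  open Unipotent (Z G) (distance-unipotent G) using (rinv; invertible)
  magnitude : ∀ M → IsInverse (Z G) M → (entrySum M 0 ≡ + v G) × (entrySum M 1 ≡ - (+ 2 * e G))
  magnitude M (ZM≡I , _) = magnitude-at-zero , magnitude-derivative
    where open Magnitude G M ZM≡I
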